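{- Let $H$ be a linear hypergraph and $\mathscr{N}$ a forest of copies in $H$ with $|\mathscr{N}|\ge2$. Then $\mathscr{N}$ has at least two terminal copies.
   Context: Hypergraphs are pairs $(V,E)$ with $E$ a set of $k$-subsets of a finite set $V$; linear means two distinct edges share at most one vertex. For a finite set $\mathscr{N}$ of subhypergraphs of $H$ (these may include edge copies $e^+=(e,\{e\})$, $e\in E(H)$), an enumeration $(F_1,\dots,F_{|\mathscr{N}|})$ of $\mathscr{N}$ is admissible if for every $j\in[2,|\mathscr{N}|]$ the set $z_j=V(F_j)\cap\bigcup_{i<j}V(F_i)$ either is an edge in $E(F_j)\cap\bigcup_{i<j}E(F_i)$ or has at most one element; $\mathscr{N}$ is a forest of copies if it has an admissible enumeration. A copy $F_\star\in\mathscr{N}$ is terminal in $\mathscr{N}$ if some admissible enumeration of $\mathscr{N}$ ends with $F_\star$. -}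

module Defs where

open import Data.Nat using (ℕ; suc; _≤_)
open import Data.Fin as Fin using (Fin; toℕ; _<_; _<?_)
open import Data.Fin.Subset using (Subset; _∈_; _⊆_; _∩_; ⋃; ∣_∣)
open import Data.Fin.Permutation using (Permutation′; _⟨$⟩ʳ_)
open import Data.List using (List; map; filter; allFin)
open import Data.Product using (Σ; _×_; ∃; ∃-syntax; _,_)
open import Data.Sum using (_⊎_)
open import Relation.Binary.PropositionalEquality using (_≡_; _≢_)
open import Function.Definitions using (Injective)

record Hypergraph : Set where
  field
    n m k   : ℕ
    edge    : Fin m → Subset n
    edgeInj : Injective _≡_ _≡_ edge
    uniform : ∀ e → ∣ edge e ∣ ≡ k
open Hypergraph public

Linear : Hypergraph → Set
Linear H = ∀ e f → e ≢ f → ∣ edge H e ∩ edge H f ∣ ≤ 1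

record Sub (H : Hypergraph) : Set where
  constructor sub
  field
    verts : Subset (n H)
    edges : Subset (m H)
open Sub public

IsSubhypergraph : (H : Hypergraph) → Sub H → Set
IsSubhypergraph H F = ∀ e → e ∈ edges F → edge H e ⊆ verts F

module _ (H : Hypergraph) {M : ℕ} (𝒩 : Fin M → Sub H) where

  -- enumeration F_p = 𝒩 (σ p) for positions p : Fin M
  -- positions strictly before p
  before : Fin M → List (Fin M)
  before p = filter (_<? p) (allFin M)

  z : Permutation′ M → Fin M → Subset (n H)
  z σ p = verts (𝒩 (σ ⟨$⟩ʳ p)) ∩ ⋃ (map (λ i → verts (𝒩 (σ ⟨$⟩ʳ i))) (before p))

  Admissible : Permutation′ M → Set
  Admissible σ = ∀ (p : Fin M) → 1 ≤ toℕ p →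
      (∃[ e ] (e ∈ edges (𝒩 (σ ⟨$⟩ʳ p))
               × (∃[ i ] (i < p × e ∈ edges (𝒩 (σ ⟨$⟩ʳ i))))
               × edge H e ≡ z σ p))
    ⊎ ∣ z σ p ∣ ≤ 1

  ForestOfCopies : Set
  ForestOfCopies = ∃[ σ ] Admissible σ

  Terminal : Fin M → Set
  Terminal t = ∃[ σ ] (Admissible σ × ∃[ p ] (suc (toℕ p) ≡ M × σ ⟨$⟩ʳ p ≡ t))

module Submission where

-- Induct along an admissible enumeration F₁, …, F_M, keeping two distinct
-- copies among F₁, …, F_L each of which can be moved behind the others without
-- losing admissibility. When N = F_{L+1} is appended it is itself last, and one
-- of the two old copies a, b can still be moved behind N. If z_N is an edge of
-- an earlier copy C, take x ∈ {a, b} other than C: z_N stays the same without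
-- x, and V(x) ∩ V(N) ⊆ z_N ⊆ V(C). If |z_N| ≤ 1 and a meets N, then b can meet
-- N only in that same vertex, which lies in V(a). Either way the vertices x
-- shares with N are covered by other earlier copies, so moving x past N leaves
-- z_x unchanged.

open import Defs
open import Data.Nat using (ℕ; _≤_; zero; suc; z≤n; s≤s)
import Data.Nat as ℕ
import Data.Nat.Properties as ℕ
open import Data.Fin using (Fin; toℕ; fromℕ; fromℕ<; inject₁; punchIn; _<_; _<?_; _≟_)
import Data.Fin.Properties as Fin
open import Data.Fin.Patterns using (0F; 1F)
open import Data.Fin.Relation.Unary.Top using (view; ‵fromℕ; ‵inject₁)
open import Data.Fin.Subset using (Subset; _∈_; _∉_; _∩_; ⋃; ∣_∣; inside; outside; ⊥)
open import Data.Fin.Subset.Properties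
  using (⊆-antisym; x∈p∩q⁺; x∈p∩q⁻; x∈p∪q⁺; x∈p∪q⁻; ∉⊥; ∣⊥∣≡0; Empty-unique; nonempty?)
open import Data.Fin.Permutation
  using (Permutation′; _⟨$⟩ʳ_; _⟨$⟩ˡ_; _∘ₚ_; inverseʳ; insert; insert-punchIn; id)
open import Data.List as List using (List; map; allFin)
open import Data.List.Membership.Propositional using () renaming (_∈_ to _∈ₗ_)
open import Data.List.Membership.Propositional.Properties using (∈-filter⁺; ∈-filter⁻; ∈-allFin)
import Data.List.Relation.Unary.Any as Any
open import Data.Vec using ([]; _∷_; here; there)
open import Data.Product as Prod using (_×_; ∃-syntax; _,_; proj₁; proj₂)
open import Data.Sum as Sum using (_⊎_; inj₁; inj₂)
open import Function using (_∘_)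
open import Function.Bundles using (Injection)
open import Function.Properties.Inverse using (↔⇒↣)
open import Relation.Nullary using (¬_; yes; no; contradiction)
open import Relation.Binary.PropositionalEquality
  using (_≡_; _≢_; refl; sym; trans; cong; subst; subst₂)
open import Function.Definitions using (Injective)

∣p∣≡0⇒x∉p : ∀ {n} {p : Subset n} {x} → ∣ p ∣ ≡ 0 → x ∉ p
∣p∣≡0⇒x∉p {p = outside ∷ p} ∣p∣≡0 (there x∈p) = ∣p∣≡0⇒x∉p ∣p∣≡0 x∈p

∣p∣≤1⇒x≡y : ∀ {n} {p : Subset n} {x y} → ∣ p ∣ ≤ 1 → x ∈ p → y ∈ p → x ≡ y
∣p∣≤1⇒x≡y {p = outside ∷ p} ∣p∣≤1 (there x∈p) (there y∈p) =
  cong Fin.suc (∣p∣≤1⇒x≡y ∣p∣≤1 x∈p y∈p)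
∣p∣≤1⇒x≡y {p = inside ∷ p} _ here here = refl
∣p∣≤1⇒x≡y {p = inside ∷ p} (s≤s ∣p∣≤0) here (there y∈p) =
  contradiction y∈p (∣p∣≡0⇒x∉p (ℕ.n≤0⇒n≡0 ∣p∣≤0))
∣p∣≤1⇒x≡y {p = inside ∷ p} (s≤s ∣p∣≤0) (there x∈p) _ =
  contradiction x∈p (∣p∣≡0⇒x∉p (ℕ.n≤0⇒n≡0 ∣p∣≤0))

x≡y⇒∣p∣≤1 : ∀ {n} (p : Subset n) → (∀ {x y} → x ∈ p → y ∈ p → x ≡ y) → ∣ p ∣ ≤ 1
x≡y⇒∣p∣≤1 [] _ = z≤n
x≡y⇒∣p∣≤1 (outside ∷ p) unique =
  x≡y⇒∣p∣≤1 p (λ x∈p y∈p → Fin.suc-injective (unique (there x∈p) (there y∈p)))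
x≡y⇒∣p∣≤1 {suc n} (inside ∷ p) unique = s≤s (ℕ.≤-reflexive (trans (cong ∣_∣ p≡⊥) (∣⊥∣≡0 n)))
  where
  p≡⊥ : p ≡ ⊥
  p≡⊥ = Empty-unique (λ (_ , x∈p) → Fin.0≢1+n (unique here (there x∈p)))

x∈⋃-map⁻ : ∀ {n} {A : Set} (f : A → Subset n) (as : List A) {x} →
           x ∈ ⋃ (map f as) → ∃[ a ] (a ∈ₗ as × x ∈ f a)
x∈⋃-map⁻ f List.[] x∈⊥ = contradiction x∈⊥ ∉⊥
x∈⋃-map⁻ f (a List.∷ as) x∈⋃ with x∈p∪q⁻ (f a) (⋃ (map f as)) x∈⋃
... | inj₁ x∈fa = a , Any.here refl , x∈fa
... | inj₂ x∈⋃as with x∈⋃-map⁻ f as x∈⋃as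
...   | b , b∈as , x∈fb = b , Any.there b∈as , x∈fb

x∈⋃-map⁺ : ∀ {n} {A : Set} (f : A → Subset n) {as : List A} {x a} →
           a ∈ₗ as → x ∈ f a → x ∈ ⋃ (map f as)
x∈⋃-map⁺ f (Any.here refl) x∈fa = x∈p∪q⁺ (inj₁ x∈fa)
x∈⋃-map⁺ f (Any.there a∈as) x∈fa = x∈p∪q⁺ (inj₂ (x∈⋃-map⁺ f a∈as x∈fa))

module _ {H : Hypergraph} {M : ℕ} (F : Fin M → Sub H) where

  Overlap : (Fin M → Set) → Fin M → Fin (n H) → Set
  Overlap P j y = y ∈ verts (F j) × ∃[ i ] (P i × y ∈ verts (F i))

  UniqueOverlap : (Fin M → Set) → Fin M → Set
  UniqueOverlap P j = ∀ {y y′} → Overlap P j y → Overlap P j y′ → y ≡ y′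

  -- The condition an admissible enumeration imposes on F j when the copies
  -- before it are those satisfying P; z_j is the set of y with Overlap P j y.
  Attached : (Fin M → Set) → Fin M → Set
  Attached P j =
      (∃[ e ] (e ∈ edges (F j) × (∃[ i ] (P i × e ∈ edges (F i)))
               × (∀ {y} → y ∈ edge H e → Overlap P j y)
               × (∀ {y} → Overlap P j y → y ∈ edge H e)))
    ⊎ UniqueOverlap P j

  Overlap-mono : ∀ {P Q : Fin M → Set} {j y} → (∀ {i} → P i → Q i) → Overlap P j y → Overlap Q j y
  Overlap-mono P⊆Q (y∈j , i , Pi , y∈i) = y∈j , i , P⊆Q Pi , y∈i

  UniqueOverlap-antimono : ∀ {P Q : Fin M → Set} {j} → (∀ {i} → Q i → P i) →
                           UniqueOverlap P j → UniqueOverlap Q j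
  UniqueOverlap-antimono Q⊆P unique o o′ = unique (Overlap-mono Q⊆P o) (Overlap-mono Q⊆P o′)

  Attached-mono : ∀ {P Q : Fin M → Set} {j} → (∀ {i} → P i → Q i) →
                  (∀ {y} → Overlap Q j y → Overlap P j y) → Attached P j → Attached Q j
  Attached-mono P⊆Q shrink (inj₁ (e , e∈j , (i , Pi , e∈i) , e⊆ , ⊆e)) =
    inj₁ (e , e∈j , (i , P⊆Q Pi , e∈i) , Overlap-mono P⊆Q ∘ e⊆ , ⊆e ∘ shrink)
  Attached-mono _ shrink (inj₂ unique) = inj₂ (λ o o′ → unique (shrink o) (shrink o′))

  Attached-cong : ∀ {P Q : Fin M → Set} {j} → (∀ {i} → P i → Q i) → (∀ {i} → Q i → P i) →
                  Attached P j → Attached Q j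
  Attached-cong P⊆Q Q⊆P = Attached-mono P⊆Q (Overlap-mono Q⊆P)

  Attached-∅ : ∀ {P : Fin M → Set} {j} → (∀ {i} → ¬ P i) → Attached P j
  Attached-∅ ¬P = inj₂ (λ (_ , _ , Pi , _) → contradiction Pi ¬P)

  Overlap-swap : ∀ {a b y} → Overlap (_≡ b) a y → Overlap (_≡ a) b y
  Overlap-swap (y∈a , _ , refl , y∈b) = y∈b , _ , refl , y∈a

  Attached-swap : ∀ {a b} → Attached (_≡ b) a → Attached (_≡ a) b
  Attached-swap (inj₁ (e , e∈a , (_ , refl , e∈b) , e⊆ , ⊆e)) =
    inj₁ (e , e∈b , (_ , refl , e∈a) , Overlap-swap ∘ e⊆ , ⊆e ∘ Overlap-swap)
  Attached-swap (inj₂ unique) = inj₂ (λ o o′ → unique (Overlap-swap o) (Overlap-swap o′))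

module _ {H : Hypergraph} {M : ℕ} (F : Fin M → Sub H) (τ : Permutation′ M) {P : Fin M → Set} where

  Overlap-reindex⁺ : ∀ {p y} → Overlap F P (τ ⟨$⟩ʳ p) y →
                     Overlap (F ∘ (τ ⟨$⟩ʳ_)) (P ∘ (τ ⟨$⟩ʳ_)) p y
  Overlap-reindex⁺ {y = y} (y∈p , i , Pi , y∈i) =
    y∈p , τ ⟨$⟩ˡ i , subst P (sym (inverseʳ τ)) Pi , subst (λ i → y ∈ verts (F i)) (sym (inverseʳ τ)) y∈i

  Overlap-reindex⁻ : ∀ {p y} → Overlap (F ∘ (τ ⟨$⟩ʳ_)) (P ∘ (τ ⟨$⟩ʳ_)) p y →
                     Overlap F P (τ ⟨$⟩ʳ p) y
  Overlap-reindex⁻ (y∈p , q , Pq , y∈q) = y∈p , τ ⟨$⟩ʳ q , Pq , y∈q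

  Attached-reindex : ∀ {p} → Attached F P (τ ⟨$⟩ʳ p) →
                     Attached (F ∘ (τ ⟨$⟩ʳ_)) (P ∘ (τ ⟨$⟩ʳ_)) p
  Attached-reindex (inj₁ (e , e∈p , (i , Pi , e∈i) , e⊆ , ⊆e)) =
    inj₁ (e , e∈p , (τ ⟨$⟩ˡ i , subst P (sym (inverseʳ τ)) Pi ,
                     subst (λ i → e ∈ edges (F i)) (sym (inverseʳ τ)) e∈i)
         , Overlap-reindex⁺ ∘ e⊆ , ⊆e ∘ Overlap-reindex⁻)
  Attached-reindex (inj₂ unique) = inj₂ (λ o o′ → unique (Overlap-reindex⁻ o) (Overlap-reindex⁻ o′))

module _ (H : Hypergraph) {M : ℕ} (𝒩 : Fin M → Sub H) (σ : Permutation′ M) where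
  private
    F : Fin M → Sub H
    F = 𝒩 ∘ (σ ⟨$⟩ʳ_)

  z⇒Overlap : ∀ p {y} → y ∈ z H 𝒩 σ p → Overlap F (_< p) p y
  z⇒Overlap p y∈z with x∈p∩q⁻ _ _ y∈z
  ... | y∈p , y∈⋃ with x∈⋃-map⁻ (verts ∘ F) (before H 𝒩 p) y∈⋃
  ...   | i , i∈before , y∈i = y∈p , i , proj₂ (∈-filter⁻ (_<? p) {xs = allFin M} i∈before) , y∈i

  Overlap⇒z : ∀ p {y} → Overlap F (_< p) p y → y ∈ z H 𝒩 σ p
  Overlap⇒z p (y∈p , i , i<p , y∈i) =
    x∈p∩q⁺ (y∈p , x∈⋃-map⁺ (verts ∘ F) (∈-filter⁺ (_<? p) (∈-allFin i) i<p) y∈i)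

  admissible⇒attached : Admissible H 𝒩 σ → ∀ p → Attached F (_< p) p
  admissible⇒attached adm Fin.zero = Attached-∅ F (λ ())
  admissible⇒attached adm p@(Fin.suc _) with adm p (s≤s z≤n)
  ... | inj₁ (e , e∈p , shared , e≡z) =
    inj₁ (e , e∈p , shared , z⇒Overlap p ∘ subst (_ ∈_) e≡z , subst (_ ∈_) (sym e≡z) ∘ Overlap⇒z p)
  ... | inj₂ ∣z∣≤1 = inj₂ (λ o o′ → ∣p∣≤1⇒x≡y ∣z∣≤1 (Overlap⇒z p o) (Overlap⇒z p o′))

  attached⇒admissible : (∀ p → Attached F (_< p) p) → Admissible H 𝒩 σ
  attached⇒admissible att p _ with att p
  ... | inj₁ (e , e∈p , shared , e⊆ , ⊆e) =
    inj₁ (e , e∈p , shared , ⊆-antisym (Overlap⇒z p ∘ e⊆) (⊆e ∘ z⇒Overlap p))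
  ... | inj₂ unique = inj₂ (x≡y⇒∣p∣≤1 _ (λ y∈z y′∈z → unique (z⇒Overlap p y∈z) (z⇒Overlap p y′∈z)))

-- MovedBefore a j i: copy i precedes copy j once copy a is moved to the end.
MovedBefore : ∀ {M} → Fin M → Fin M → Fin M → Set
MovedBefore a j i = i ≢ a × (j ≡ a ⊎ i < j)

punchIn-fromℕ : ∀ {k} (c : Fin k) → punchIn (fromℕ k) c ≡ inject₁ c
punchIn-fromℕ Fin.zero = refl
punchIn-fromℕ (Fin.suc c) = cong Fin.suc (punchIn-fromℕ c)

punchIn-mono-< : ∀ {k} (a : Fin (suc k)) {c d} → c < d → punchIn a c < punchIn a d
punchIn-mono-< a {c} {d} c<d =
  Fin.≤∧≢⇒< (Fin.punchIn-mono-≤ a c d (ℕ.<⇒≤ c<d)) (Fin.<⇒≢ c<d ∘ Fin.punchIn-injective a c d)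

punchIn-cancel-< : ∀ {k} (a : Fin (suc k)) {c d} → punchIn a c < punchIn a d → c < d
punchIn-cancel-< a {c} {d} lt =
  Fin.≤∧≢⇒< (Fin.punchIn-cancel-≤ a c d (ℕ.<⇒≤ lt)) (Fin.<⇒≢ lt ∘ cong (punchIn a))

inject₁-cancel-< : ∀ {k} {c d : Fin k} → inject₁ c < inject₁ d → c < d
inject₁-cancel-< {c = c} {d} = subst₂ ℕ._<_ (Fin.toℕ-inject₁ c) (Fin.toℕ-inject₁ d)

inject₁-mono-< : ∀ {k} {c d : Fin k} → c < d → inject₁ c < inject₁ d
inject₁-mono-< {c = c} {d} = subst₂ ℕ._<_ (sym (Fin.toℕ-inject₁ c)) (sym (Fin.toℕ-inject₁ d))

module _ {k : ℕ} (a : Fin (suc k)) where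

  moveToEnd : Permutation′ (suc k)
  moveToEnd = insert (fromℕ k) a id

  moveToEnd-fromℕ : moveToEnd ⟨$⟩ʳ fromℕ k ≡ a
  moveToEnd-fromℕ with fromℕ k ≟ fromℕ k
  ... | yes _ = refl
  ... | no k≢k = contradiction refl k≢k

  moveToEnd-inject₁ : ∀ c → moveToEnd ⟨$⟩ʳ inject₁ c ≡ punchIn a c
  moveToEnd-inject₁ c =
    subst (λ q → moveToEnd ⟨$⟩ʳ q ≡ punchIn a c) (punchIn-fromℕ c) (insert-punchIn (fromℕ k) a id c)

  moveToEnd-order⁺ : ∀ {p q} → q < p → MovedBefore a (moveToEnd ⟨$⟩ʳ p) (moveToEnd ⟨$⟩ʳ q)
  moveToEnd-order⁺ {p} {q} q<p with view p | view q
  ... | ‵fromℕ | ‵fromℕ = contradiction q<p (Fin.<-irrefl refl)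
  ... | ‵inject₁ d | ‵fromℕ = contradiction (Fin.≤fromℕ _) (ℕ.<⇒≱ q<p)
  ... | ‵fromℕ | ‵inject₁ c rewrite moveToEnd-fromℕ | moveToEnd-inject₁ c =
    Fin.punchInᵢ≢i a c , inj₁ refl
  ... | ‵inject₁ d | ‵inject₁ c rewrite moveToEnd-inject₁ d | moveToEnd-inject₁ c =
    Fin.punchInᵢ≢i a c , inj₂ (punchIn-mono-< a (inject₁-cancel-< q<p))

  moveToEnd-order⁻ : ∀ {p q} → MovedBefore a (moveToEnd ⟨$⟩ʳ p) (moveToEnd ⟨$⟩ʳ q) → q < p
  moveToEnd-order⁻ {p} {q} with view p | view q
  ... | _ | ‵fromℕ rewrite moveToEnd-fromℕ = λ (q≢a , _) → contradiction refl q≢a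
  ... | ‵fromℕ | ‵inject₁ c = λ _ → Fin.≤∧≢⇒< (Fin.≤fromℕ _) (Fin.fromℕ≢inject₁ ∘ sym)
  ... | ‵inject₁ d | ‵inject₁ c rewrite moveToEnd-inject₁ d | moveToEnd-inject₁ c = λ where
    (_ , inj₁ d≡a) → contradiction d≡a (Fin.punchInᵢ≢i a d)
    (_ , inj₂ c<d) → inject₁-mono-< (punchIn-cancel-< a c<d)

module _ {H : Hypergraph} {M : ℕ} (F : Fin M → Sub H) where

  -- the first L copies, with a moved behind all the others, are enumerated admissibly
  Movable : ℕ → Fin M → Set
  Movable L a = (∀ j → toℕ j ℕ.< L → j ≢ a → Attached F (λ i → i ≢ a × i < j) j)
              × Attached F (λ i → i ≢ a × toℕ i ℕ.< L) a

  OverlapCovered : Fin M → Fin M → Set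
  OverlapCovered x N = ∀ {y} → y ∈ verts (F x) → y ∈ verts (F N) →
                       ∃[ i ] ((i ≢ x × i < N) × y ∈ verts (F i))

  Extendable : Fin M → Fin M → Set
  Extendable x N = Attached F (λ i → i ≢ x × i < N) N × OverlapCovered x N

  movable-last : (∀ j → Attached F (_< j) j) → ∀ N → Movable (suc (toℕ N)) N
  movable-last attached N =
      (λ j j≤N _ → Attached-cong F (λ i<j → Fin.<⇒≢ (ℕ.<-≤-trans i<j (ℕ.s≤s⁻¹ j≤N)) , i<j) proj₂
                                   (attached j))
    , Attached-cong F (λ i<N → Fin.<⇒≢ i<N , ℕ.m<n⇒m<1+n i<N)
                      (λ (i≢N , i≤N) → Fin.≤∧≢⇒< (ℕ.s≤s⁻¹ i≤N) i≢N) (attached N)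

  extend-movable : ∀ {x N} → Movable (toℕ N) x → Extendable x N → Movable (suc (toℕ N)) x
  extend-movable {x} {N} (others , last) (attachedN , covered) = others′ , last′
    where
    others′ : ∀ j → toℕ j ℕ.< suc (toℕ N) → j ≢ x → Attached F (λ i → i ≢ x × i < j) j
    others′ j j≤N j≢x with j ≟ N
    ... | yes refl = attachedN
    ... | no j≢N = others j (Fin.≤∧≢⇒< (ℕ.s≤s⁻¹ j≤N) j≢N) j≢x
    shrink : ∀ {y} → Overlap F (λ i → i ≢ x × toℕ i ℕ.< suc (toℕ N)) x y →
                     Overlap F (λ i → i ≢ x × i < N) x y
    shrink (y∈x , i , (i≢x , i≤N) , y∈i) with i ≟ N
    ... | yes refl = y∈x , covered y∈x y∈i
    ... | no i≢N = y∈x , i , (i≢x , Fin.≤∧≢⇒< (ℕ.s≤s⁻¹ i≤N) i≢N) , y∈i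
    last′ : Attached F (λ i → i ≢ x × toℕ i ℕ.< suc (toℕ N)) x
    last′ = Attached-mono F (λ (i≢x , i<N) → i≢x , ℕ.m<n⇒m<1+n i<N) shrink last

  choose-extendable : (∀ j → IsSubhypergraph H (F j)) → ∀ {a b N} → a ≢ b → a < N → b < N →
                      Attached F (_< N) N → Extendable a N ⊎ Extendable b N
  choose-extendable isSub {a} {b} {N} a≢b a<N b<N (inj₁ (e , e∈N , (c , c<N , e∈c) , e⊆ , ⊆e)) =
    Sum.map (avoiding a<N) (avoiding b<N) (c≢a⊎c≢b c)
    where
    c≢a⊎c≢b : ∀ c → c ≢ a ⊎ c ≢ b
    c≢a⊎c≢b c with c ≟ a
    ... | yes refl = inj₂ a≢b
    ... | no c≢a = inj₁ c≢a
    avoiding : ∀ {x} → x < N → c ≢ x → Extendable x N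
    avoiding x<N c≢x =
        inj₁ (e , e∈N , (c , (c≢x , c<N) , e∈c)
             , (λ y∈e → proj₁ (e⊆ y∈e) , c , (c≢x , c<N) , isSub c e e∈c y∈e)
             , ⊆e ∘ Overlap-mono F proj₂)
      , λ y∈x y∈N → c , (c≢x , c<N) , isSub c e e∈c (⊆e (y∈N , _ , x<N , y∈x))
  choose-extendable isSub {a} {b} {N} a≢b a<N b<N (inj₂ unique)
    with nonempty? (verts (F a) ∩ verts (F N))
  ... | no disjoint = inj₁ (inj₂ (UniqueOverlap-antimono F proj₂ unique) ,
                            λ y∈a y∈N → contradiction (_ , x∈p∩q⁺ (y∈a , y∈N)) disjoint)
  ... | yes (y , y∈a∩N) = inj₂ (inj₂ (UniqueOverlap-antimono F proj₂ unique) , covered)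
    where
    covered : OverlapCovered b N
    covered {y′} y′∈b y′∈N with x∈p∩q⁻ _ _ y∈a∩N
    ... | y∈a , y∈N = a , (a≢b , a<N) ,
      subst (_∈ verts (F a)) (unique (y∈N , a , a<N , y∈a) (y′∈N , b , b<N , y′∈b)) y∈a

  movable⇒attached-movedBefore : ∀ {a} → Movable M a → ∀ j → Attached F (MovedBefore a j) j
  movable⇒attached-movedBefore {a} (others , last) j with j ≟ a
  ... | yes refl = Attached-cong F (λ (i≢a , _) → i≢a , inj₁ refl) (λ (i≢a , _) → i≢a , Fin.toℕ<n _) last
  ... | no j≢a = Attached-cong F (Prod.map₂ inj₂) before-j (others j (Fin.toℕ<n j) j≢a)
    where
    before-j : ∀ {i} → MovedBefore a j i → i ≢ a × i < j
    before-j (_ , inj₁ j≡a) = contradiction j≡a j≢a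
    before-j (i≢a , inj₂ i<j) = i≢a , i<j

movable⇒moveToEnd-attached : ∀ {H k} (F : Fin (suc k) → Sub H) {a} → Movable F (suc k) a →
                         ∀ p → Attached (F ∘ (moveToEnd a ⟨$⟩ʳ_)) (_< p) p
movable⇒moveToEnd-attached F {a} movable p =
  Attached-cong (F ∘ (moveToEnd a ⟨$⟩ʳ_)) (moveToEnd-order⁻ a) (moveToEnd-order⁺ a)
    (Attached-reindex F (moveToEnd a) (movable⇒attached-movedBefore F movable (moveToEnd a ⟨$⟩ʳ p)))

module _ {H : Hypergraph} {k : ℕ} (F : Fin (suc (suc k)) → Sub H)
         (isSub : ∀ j → IsSubhypergraph H (F j)) (attached : ∀ j → Attached F (_< j) j) where

  TwoMovable : ℕ → Set
  TwoMovable L = ∃[ a ] ∃[ b ] (a ≢ b × toℕ a ℕ.< L × toℕ b ℕ.< L × Movable F L a × Movable F L b)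

  movable-first : Movable F 2 0F
  movable-first =
    others , Attached-cong F from-1 to-1 (Attached-swap F (Attached-cong F <1⇒≡0 ≡0⇒<1 (attached 1F)))
    where
    <1⇒≡0 : ∀ {i : Fin (suc (suc k))} → toℕ i ℕ.< 1 → i ≡ 0F
    <1⇒≡0 {0F} _ = refl
    <1⇒≡0 {Fin.suc _} (s≤s ())
    others : ∀ j → toℕ j ℕ.< 2 → j ≢ 0F → Attached F (λ i → i ≢ 0F × i < j) j
    others 0F _ 0≢0 = contradiction refl 0≢0
    others 1F _ _ = Attached-∅ F (λ (i≢0 , i<1) → i≢0 (<1⇒≡0 i<1))
    others (Fin.suc (Fin.suc _)) (s≤s (s≤s ())) _
    ≡0⇒<1 : ∀ {i : Fin (suc (suc k))} → i ≡ 0F → toℕ i ℕ.< 1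
    ≡0⇒<1 refl = s≤s z≤n
    from-1 : ∀ {i : Fin (suc (suc k))} → i ≡ 1F → i ≢ 0F × toℕ i ℕ.< 2
    from-1 refl = (λ ()) , s≤s (s≤s z≤n)
    to-1 : ∀ {i : Fin (suc (suc k))} → i ≢ 0F × toℕ i ℕ.< 2 → i ≡ 1F
    to-1 {0F} (0≢0 , _) = contradiction refl 0≢0
    to-1 {1F} _ = refl
    to-1 {Fin.suc (Fin.suc _)} (_ , s≤s (s≤s ()))

  two-movable-suc : ∀ {L} (N : Fin (suc (suc k))) → toℕ N ≡ L → TwoMovable L → TwoMovable (suc L)
  two-movable-suc N refl (a , b , a≢b , a<N , b<N , movable-a , movable-b) =
    Sum.[ pair-with-N a<N ∘ extend-movable F movable-a , pair-with-N b<N ∘ extend-movable F movable-b ]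
      (choose-extendable F isSub a≢b a<N b<N (attached N))
    where
    pair-with-N : ∀ {x} → x < N → Movable F (suc (toℕ N)) x → TwoMovable (suc (toℕ N))
    pair-with-N x<N movable-x =
      _ , N , Fin.<⇒≢ x<N , ℕ.m<n⇒m<1+n x<N , ℕ.n<1+n _ , movable-x , movable-last F attached N

  two-movable : ∀ l → l ≤ k → TwoMovable (suc (suc l))
  two-movable zero _ =
    0F , 1F , (λ ()) , s≤s z≤n , s≤s (s≤s z≤n) , movable-first , movable-last F attached 1F
  two-movable (suc l) l<k =
    two-movable-suc (fromℕ< (s≤s (s≤s l<k))) (Fin.toℕ-fromℕ< (s≤s (s≤s l<k))) (two-movable l (ℕ.<⇒≤ l<k))

lemma13p2 : (H : Hypergraph) → Linear H →
    (M : ℕ) (𝒩 : Fin M → Sub H) → Injective _≡_ _≡_ 𝒩 →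
    (∀ i → IsSubhypergraph H (𝒩 i)) →
    ForestOfCopies H 𝒩 → 2 ≤ M →
    ∃[ s ] ∃[ t ] (s ≢ t × Terminal H 𝒩 s × Terminal H 𝒩 t)
lemma13p2 H _ (suc (suc k)) 𝒩 _ isSub (σ , admissible) (s≤s (s≤s _)) =
  let a , b , a≢b , _ , _ , movable-a , movable-b =
        two-movable F (isSub ∘ (σ ⟨$⟩ʳ_)) (admissible⇒attached H 𝒩 σ admissible) k ℕ.≤-refl
  in σ ⟨$⟩ʳ a , σ ⟨$⟩ʳ b , a≢b ∘ Injection.injective (↔⇒↣ σ) , terminal movable-a , terminal movable-b
  where
  F : Fin (suc (suc k)) → Sub H
  F = 𝒩 ∘ (σ ⟨$⟩ʳ_)
  terminal : ∀ {x} → Movable F (suc (suc k)) x → Terminal H 𝒩 (σ ⟨$⟩ʳ x)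
  terminal {x} movable =
    moveToEnd x ∘ₚ σ ,
    attached⇒admissible H 𝒩 (moveToEnd x ∘ₚ σ) (movable⇒moveToEnd-attached F movable) ,
    fromℕ (suc k) , cong suc (Fin.toℕ-fromℕ (suc k)) , cong (σ ⟨$⟩ʳ_) (moveToEnd-fromℕ x)
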